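{- For every integer $n\ge0$, the largest skew-corner free subset of $\Delta_{n+1}$ has size at least $\mathrm{val}(\triangle,n)$.
   Context: $\Delta_{m}=\{(a,b,c)\in\mathbb{Z}_{\ge0}^3: a+b+c=m-1\}$. A set $S\subseteq\Delta_m$ is skew-corner free if, for every permutation $\sigma$ of the three coordinates, the set $\sigma(S)$ has the property: whenever $(a,b,c),(a,b',c')\in\sigma(S)$ with $b\neq b'$, there is no point of $\sigma(S)$ whose first coordinate equals $a+b-b'$. A triple $(A,B,C)$ of subsets of $\{0,\dots,n\}$ is triforce-free if there is no solution to $a+b+c'=a+b'+c=a'+b+c=n$ with $a,a'\in A$, $b,b'\in B$, $c,c'\in C$, $a\neq a'$, $b\neq b'$, $c\neq c'$; $\mathrm{val}(\triangle,n)$ is the maximum over triforce-free triples of the number of $(a,b,c)\in A\times B\times C$ with $a+b+c=n$. -}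

module Defs where

open import Data.Nat using (ℕ; _+_; _≤_)
open import Data.Nat.Properties using (_≟_)
open import Data.Fin using (Fin; toℕ)
open import Data.Fin.Subset using (Subset; _∈_; _∉_)
open import Data.Fin.Subset.Properties using (_∈?_)
open import Data.List using (List; []; _∷_; map; length; filter; cartesianProduct; allFin)
open import Data.List.Membership.Propositional renaming (_∈_ to _∈ₗ_)
open import Data.List.Relation.Unary.All using (All)
open import Data.List.Relation.Unary.Unique.Propositional using (Unique)
open import Data.Product using (_×_; _,_; Σ; ∃-syntax)
open import Relation.Binary.PropositionalEquality using (_≡_; _≢_)
open import Relation.Nullary using (¬_; Dec; yes; no)
open import Relation.Nullary.Decidable using (_×-dec_)

Triple : Set
Triple = ℕ × ℕ × ℕ

-- Membership in Δ_m, i.e. a + b + c = m - 1.  We use Δ_{n+1}: a + b + c = n.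
InΔ : ℕ → Triple → Set
InΔ n (a , b , c) = a + b + c ≡ n

permutations : List (Triple → Triple)
permutations =
    (λ { (a , b , c) → (a , b , c) })
  ∷ (λ { (a , b , c) → (a , c , b) })
  ∷ (λ { (a , b , c) → (b , a , c) })
  ∷ (λ { (a , b , c) → (b , c , a) })
  ∷ (λ { (a , b , c) → (c , a , b) })
  ∷ (λ { (a , b , c) → (c , b , a) })
  ∷ []

-- The defining property for a single (permuted) set T:
-- whenever (a,b,c),(a,b',c') ∈ T with b ≠ b', no point of T has first
-- coordinate equal to a + b - b' (written additively: x + b' = a + b).
SkewCornerProp : List Triple → Set
SkewCornerProp T =
  ∀ a b c b' c' x y z →
    (a , b , c) ∈ₗ T → (a , b' , c') ∈ₗ T → b ≢ b' →
    (x , y , z) ∈ₗ T → x + b' ≢ a + b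

SkewCornerFree : List Triple → Set
SkewCornerFree S = ∀ σ → σ ∈ₗ permutations → SkewCornerProp (map σ S)

TriforceFree : (n : ℕ) → Subset (Data.Nat.suc n) → Subset (Data.Nat.suc n) → Subset (Data.Nat.suc n) → Set
TriforceFree n A B C =
  ¬ (Σ (Fin (Data.Nat.suc n)) λ a → Σ (Fin (Data.Nat.suc n)) λ a' →
     Σ (Fin (Data.Nat.suc n)) λ b → Σ (Fin (Data.Nat.suc n)) λ b' →
     Σ (Fin (Data.Nat.suc n)) λ c → Σ (Fin (Data.Nat.suc n)) λ c' →
       (a ∈ A) × (a' ∈ A) × (b ∈ B) × (b' ∈ B) × (c ∈ C) × (c' ∈ C) ×
       (a ≢ a') × (b ≢ b') × (c ≢ c') ×
       (toℕ a + toℕ b + toℕ c' ≡ n) ×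
       (toℕ a + toℕ b' + toℕ c ≡ n) ×
       (toℕ a' + toℕ b + toℕ c ≡ n))

tripleCount : (n : ℕ) → Subset (Data.Nat.suc n) → Subset (Data.Nat.suc n) → Subset (Data.Nat.suc n) → ℕ
tripleCount n A B C =
  length (filter (λ { (a , b , c) →
            (a ∈? A) ×-dec (b ∈? B) ×-dec (c ∈? C) ×-dec (toℕ a + toℕ b + toℕ c ≟ n) })
          (cartesianProduct (allFin _) (cartesianProduct (allFin _) (allFin _))))

-- For a triforce-free (A, B, C) take S = (A × B × C) ∩ Δ, of size tripleCount.
-- If (a,b,c), (a,b',c') ∈ S with b ≠ b' and some point of S has first coordinate
-- x = a + b − b', then x ∈ A and (x,b',c) ∈ Δ, so (a,b',c'), (a,b,c), (x,b',c)
-- is a triforce.  Triforce-freeness is symmetric in the three coordinates,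
-- so the same argument applies to every permuted copy of S.
module Submission where

open import Defs
open import Data.Nat using (ℕ; suc; _≤_; _+_)
open import Data.Nat.Properties using (+-cancelˡ-≡; +-cancelʳ-≡; ≤-reflexive; _≟_; +-commutativeSemigroup)
open import Algebra.Properties.CommutativeSemigroup +-commutativeSemigroup using (xy∙z≈yx∙z; xy∙z≈xz∙y)
open import Data.Empty using (⊥)
open import Data.Fin using (Fin; toℕ)
open import Data.Fin.Properties using (toℕ-injective)
open import Data.Fin.Subset using (Subset; _∈_)
open import Data.Fin.Subset.Properties using (_∈?_)
open import Data.List using (List; length; map; filter; cartesianProduct; allFin)
open import Data.List.Properties using (length-map)
open import Data.List.Membership.Propositional renaming (_∈_ to _∈ₗ_)
open import Data.List.Membership.Propositional.Properties using (∈-map⁻; ∈-filter⁻)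
open import Data.List.Relation.Unary.Any using (here; there)
open import Data.List.Relation.Unary.All as All using (All)
open import Data.List.Relation.Unary.Unique.Propositional using (Unique)
open import Data.List.Relation.Unary.Unique.Propositional.Properties
  using (map⁺; filter⁺; cartesianProduct⁺; allFin⁺)
open import Data.Product using (Σ; _×_; ∃-syntax; _,_; proj₁; proj₂)
open import Data.Product.Properties using (,-injectiveˡ; ,-injectiveʳ)
open import Function using (id; _∘_)
open import Level using (0ℓ)
open import Relation.Binary.PropositionalEquality
open import Relation.Nullary.Decidable using (_×-dec_)
open import Relation.Unary using (Pred; Decidable)

module Triforce (n : ℕ) where

  record Supported (P Q R : Pred ℕ 0ℓ) (t : Triple) : Set where
    constructor supported
    field
      first  : P (proj₁ t)
      second : Q (proj₁ (proj₂ t))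
      third  : R (proj₂ (proj₂ t))
      onΔ    : InΔ n t

  NoTriforce : (P Q R : Pred ℕ 0ℓ) → Set
  NoTriforce P Q R = ∀ {a a' b b' c c'} → a ≢ a' → b ≢ b' → c ≢ c' →
    Supported P Q R (a , b , c') → Supported P Q R (a , b' , c) → Supported P Q R (a' , b , c) → ⊥

  supported-swap₁₂ : ∀ {P Q R a b c} → Supported P Q R (a , b , c) → Supported Q P R (b , a , c)
  supported-swap₁₂ {a = a} {b} {c} (supported p q r s) = supported q p r (trans (xy∙z≈yx∙z b a c) s)

  supported-swap₂₃ : ∀ {P Q R a b c} → Supported P Q R (a , b , c) → Supported P R Q (a , c , b)
  supported-swap₂₃ {a = a} {b} {c} (supported p q r s) = supported p r q (trans (xy∙z≈xz∙y a c b) s)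

  noTriforce-swap₁₂ : ∀ {P Q R} → NoTriforce P Q R → NoTriforce Q P R
  noTriforce-swap₁₂ noTri b≢b' a≢a' c≢c' s₁ s₂ s₃ =
    noTri a≢a' b≢b' c≢c' (supported-swap₁₂ s₁) (supported-swap₁₂ s₃) (supported-swap₁₂ s₂)

  noTriforce-swap₂₃ : ∀ {P Q R} → NoTriforce P Q R → NoTriforce P R Q
  noTriforce-swap₂₃ noTri a≢a' c≢c' b≢b' s₁ s₂ s₃ =
    noTri a≢a' b≢b' c≢c' (supported-swap₂₃ s₂) (supported-swap₂₃ s₁) (supported-swap₂₃ s₃)

  skewCornerProp-supported : ∀ {P Q R} → NoTriforce P Q R → (T : List Triple) →
    (∀ {t} → t ∈ₗ T → Supported P Q R t) → SkewCornerProp T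
  skewCornerProp-supported noTri T supp a b c b' c' x y z abc∈T ab'c'∈T b≢b' xyz∈T x+b'≡a+b
    with supp abc∈T | supp ab'c'∈T | supp xyz∈T
  ... | supported pa qb rc abc≡n | supported _ qb' rc' ab'c'≡n | supported px _ _ _ =
    noTri a≢x (b≢b' ∘ sym) c≢c' (supported pa qb' rc' ab'c'≡n) (supported pa qb rc abc≡n)
      (supported px qb' rc (trans (cong (_+ c) x+b'≡a+b) abc≡n))
    where
    a≢x : a ≢ x
    a≢x refl = b≢b' (sym (+-cancelˡ-≡ a b' b x+b'≡a+b))
    c≢c' : c ≢ c'
    c≢c' refl = b≢b' (+-cancelˡ-≡ a b b' (+-cancelʳ-≡ c (a + b) (a + b') (trans abc≡n (sym ab'c'≡n))))

  skewCornerProp-map : ∀ {P Q R P' Q' R'} (σ : Triple → Triple) →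
    (∀ {t} → Supported P Q R t → Supported P' Q' R' (σ t)) → NoTriforce P' Q' R' →
    (S : List Triple) → (∀ {t} → t ∈ₗ S → Supported P Q R t) → SkewCornerProp (map σ S)
  skewCornerProp-map σ σ-supp noTri S supp = skewCornerProp-supported noTri (map σ S) σS-supp
    where
    σS-supp : ∀ {t} → t ∈ₗ map σ S → Supported _ _ _ t
    σS-supp t∈σS with ∈-map⁻ σ t∈σS
    ... | _ , t∈S , refl = σ-supp (supp t∈S)

  skewCornerFree-supported : ∀ {P Q R} → NoTriforce P Q R →
    (S : List Triple) → (∀ {t} → t ∈ₗ S → Supported P Q R t) → SkewCornerFree S
  skewCornerFree-supported noTri S supp _ (here refl) =
    skewCornerProp-map _ id noTri S supp
  skewCornerFree-supported noTri S supp _ (there (here refl)) =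
    skewCornerProp-map _ supported-swap₂₃ (noTriforce-swap₂₃ noTri) S supp
  skewCornerFree-supported noTri S supp _ (there (there (here refl))) =
    skewCornerProp-map _ supported-swap₁₂ (noTriforce-swap₁₂ noTri) S supp
  skewCornerFree-supported noTri S supp _ (there (there (there (here refl)))) =
    skewCornerProp-map _ (supported-swap₂₃ ∘ supported-swap₁₂)
      (noTriforce-swap₂₃ (noTriforce-swap₁₂ noTri)) S supp
  skewCornerFree-supported noTri S supp _ (there (there (there (there (here refl))))) =
    skewCornerProp-map _ (supported-swap₁₂ ∘ supported-swap₂₃)
      (noTriforce-swap₁₂ (noTriforce-swap₂₃ noTri)) S supp
  skewCornerFree-supported noTri S supp _ (there (there (there (there (there (here refl)))))) =
    skewCornerProp-map _ (supported-swap₁₂ ∘ supported-swap₂₃ ∘ supported-swap₁₂)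
      (noTriforce-swap₁₂ (noTriforce-swap₂₃ (noTriforce-swap₁₂ noTri))) S supp

_∈ᴺ_ : ∀ {m} → ℕ → Subset m → Set
k ∈ᴺ X = ∃[ i ] toℕ i ≡ k × i ∈ X

Fin³ : ℕ → Set
Fin³ m = Fin m × Fin m × Fin m

toℕ³ : ∀ {m} → Fin³ m → Triple
toℕ³ (a , b , c) = toℕ a , toℕ b , toℕ c

toℕ³-injective : ∀ {m} {s t : Fin³ m} → toℕ³ s ≡ toℕ³ t → s ≡ t
toℕ³-injective {s = a , b , c} {a' , b' , c'} eq
  with toℕ-injective (,-injectiveˡ eq) | toℕ-injective (,-injectiveˡ (,-injectiveʳ eq))
     | toℕ-injective (,-injectiveʳ (,-injectiveʳ eq))
... | refl | refl | refl = refl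

grid : ∀ m → List (Fin³ m)
grid m = cartesianProduct (allFin m) (cartesianProduct (allFin m) (allFin m))

grid-unique : ∀ m → Unique (grid m)
grid-unique m = cartesianProduct⁺ (allFin⁺ m) (cartesianProduct⁺ (allFin⁺ m) (allFin⁺ m))

module Slice (n : ℕ) (A B C : Subset (suc n)) where
  open Triforce n

  InSlice : Pred (Fin³ (suc n)) 0ℓ
  InSlice (a , b , c) = a ∈ A × b ∈ B × c ∈ C × toℕ a + toℕ b + toℕ c ≡ n

  inSlice? : Decidable InSlice
  inSlice? (a , b , c) = (a ∈? A) ×-dec (b ∈? B) ×-dec (c ∈? C) ×-dec (toℕ a + toℕ b + toℕ c ≟ n)

  slice : List Triple
  slice = map toℕ³ (filter inSlice? (grid (suc n)))

  slice-unique : Unique slice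
  slice-unique = map⁺ toℕ³-injective (filter⁺ inSlice? (grid-unique (suc n)))

  slice-supported : ∀ {t} → t ∈ₗ slice → Supported (_∈ᴺ A) (_∈ᴺ B) (_∈ᴺ C) t
  slice-supported t∈S with ∈-map⁻ toℕ³ t∈S
  ... | (a , b , c) , abc∈filter , refl with proj₂ (∈-filter⁻ inSlice? {xs = grid (suc n)} abc∈filter)
  ... | a∈A , b∈B , c∈C , abc≡n = supported (a , refl , a∈A) (b , refl , b∈B) (c , refl , c∈C) abc≡n

  slice-inΔ : All (InΔ n) slice
  slice-inΔ = All.tabulate (Supported.onΔ ∘ slice-supported)

  tripleCount≡length-slice : tripleCount n A B C ≡ length slice
  tripleCount≡length-slice = sym (length-map toℕ³ (filter inSlice? (grid (suc n))))

  triforceFree⇒noTriforce : TriforceFree n A B C → NoTriforce (_∈ᴺ A) (_∈ᴺ B) (_∈ᴺ C)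
  triforceFree⇒noTriforce triforceFree a≢a' b≢b' c≢c'
    (supported (a , refl , a∈A) (b , refl , b∈B) (c' , refl , c'∈C) abc'≡n)
    (supported _ (b' , refl , b'∈B) (c , refl , c∈C) ab'c≡n)
    (supported (a' , refl , a'∈A) _ _ a'bc≡n) =
    triforceFree (a , a' , b , b' , c , c' , a∈A , a'∈A , b∈B , b'∈B , c∈C , c'∈C ,
      a≢a' ∘ cong toℕ , b≢b' ∘ cong toℕ , c≢c' ∘ cong toℕ , abc'≡n , ab'c≡n , a'bc≡n)

proposition4p13 : (n : ℕ) → (A B C : Subset (suc n)) → TriforceFree n A B C →
    Σ (List Triple) λ S →
      Unique S × All (InΔ n) S × SkewCornerFree S × (tripleCount n A B C ≤ length S)
proposition4p13 n A B C triforceFree =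
  slice , slice-unique , slice-inΔ ,
  Triforce.skewCornerFree-supported n (triforceFree⇒noTriforce triforceFree) slice slice-supported ,
  ≤-reflexive tripleCount≡length-slice
  where open Slice n A B C
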